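{- $M_i$ is a perfect stable matching of $I_T$ if and only if $M_i\mathcal{O}_I$ is a reduced stable partition of $I$, where $\mathcal{O}_I$ are the invariant odd cycles of $I$.
   Context: An SR (Stable Roommates) instance $I=(A,\succ)$ consists of an even number $n$ of agents, each with a strict complete preference ranking over all other agents (and ranking itself last). A stable partition is a permutation $\Pi$ of $A$ such that (T1) every agent weakly prefers its successor $\Pi(a_i)$ to its predecessor $\Pi^{ -1}(a_i)$, and (T2) there are no two distinct agents $a_i,a_j$ with $a_j \succ_i \Pi^{ -1}(a_i)$ and $a_i \succ_j \Pi^{ -1}(a_j)$. It is reduced if all its cycles have length 2 or odd length. The odd cycles $\mathcal{O}_I$ are the same in all stable partitions of $I$. Let $I_E=(A',\succ')$ with $A'=A\setminus A(\mathcal{O}_I)$ and $\succ'$ the restriction of $\succ$ to $A'$. The instance $I_T=(A',\succ'')$ (possibly with incomplete lists) is obtained from $I_E$ by making each pair $\{a_i,a_j\}\subseteq A'$ mutually unacceptable whenever there is an agent $a_r\in A(\mathcal{O}_I)$ with $a_i \succ_r \mathcal{O}_I^{ -1}(a_r)$ and $a_r \succ_i a_j$. A collection of transpositions is identified with the matching of its pairs. -}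

module Defs where

open import Data.Nat using (ℕ; zero; suc; _<_; _≤_; _%_)
open import Data.Fin using (Fin)
open import Data.Fin.Permutation using (Permutation′; _⟨$⟩ʳ_; _⟨$⟩ˡ_)
open import Data.Product using (Σ; ∃; ∃-syntax; _×_; _,_)
open import Data.Sum using (_⊎_)
open import Relation.Nullary using (¬_)
open import Relation.Binary.PropositionalEquality using (_≡_; _≢_)
open import Function.Definitions using (Injective)

-- SR instances on agents Fin n.
-- rank i j : position of agent j in agent i's list (smaller = better).

record SR (n : ℕ) : Set where
  field
    rank     : Fin n → Fin n → ℕ
    rank-inj : ∀ i → Injective _≡_ _≡_ (rank i)
    self-last : ∀ i j → j ≢ i → rank i j < rank i i

open SR public

Pref : ∀ {n} → SR n → Fin n → Fin n → Fin n → Set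
Pref I i j k = rank I i j < rank I i k

iter : ∀ {n} → (Fin n → Fin n) → ℕ → Fin n → Fin n
iter f zero    a = a
iter f (suc k) a = f (iter f k a)

CycleLength : ∀ {n} → Permutation′ n → Fin n → ℕ → Set
CycleLength Π a k =
  (1 ≤ k) × (iter (Π ⟨$⟩ʳ_) k a ≡ a) ×
  (∀ j → 1 ≤ j → j < k → iter (Π ⟨$⟩ʳ_) j a ≢ a)

OddNat : ℕ → Set
OddNat k = k % 2 ≡ 1

T1 : ∀ {n} → SR n → Permutation′ n → Set
T1 I Π = ∀ a → rank I a (Π ⟨$⟩ʳ a) ≤ rank I a (Π ⟨$⟩ˡ a)

T2 : ∀ {n} → SR n → Permutation′ n → Set
T2 I Π = ¬ (Σ _ λ i → Σ _ λ j → i ≢ j ×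
            Pref I i j (Π ⟨$⟩ˡ i) × Pref I j i (Π ⟨$⟩ˡ j))

IsStablePartition : ∀ {n} → SR n → Permutation′ n → Set
IsStablePartition I Π = T1 I Π × T2 I Π

IsReduced : ∀ {n} → Permutation′ n → Set
IsReduced Π = ∀ a k → CycleLength Π a k → (k ≡ 2) ⊎ OddNat k

-- Odd cycles O_I, taken from a (any) stable partition Π₀ of I.

-- a ∈ A(O_I): a lies on an odd cycle of Π₀ (fixed points included)
InOdd : ∀ {n} → Permutation′ n → Fin n → Set
InOdd Π₀ a = ∃[ k ] (CycleLength Π₀ a k × OddNat k)

oddPart : ∀ {n} (Π₀ : Permutation′ n) → (∀ a → InOdd Π₀ a ⊎ ¬ InOdd Π₀ a) →
          Fin n → Fin n
oddPart Π₀ dec a with dec a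
... | Data.Sum.inj₁ _ = Π₀ ⟨$⟩ʳ a
... | Data.Sum.inj₂ _ = a

-- the ordered condition: ∃ a_r ∈ A(O_I), a_i ≻_r O⁻¹(a_r) and a_r ≻_i a_j
-- (on A(O_I), O⁻¹ coincides with Π₀⁻¹)
Removed : ∀ {n} → SR n → Permutation′ n → Fin n → Fin n → Set
Removed I Π₀ i j =
  ∃[ r ] (InOdd Π₀ r × Pref I r i (Π₀ ⟨$⟩ˡ r) × Pref I i r j)

AcceptableT : ∀ {n} → SR n → Permutation′ n → Fin n → Fin n → Set
AcceptableT I Π₀ i j =
  ¬ InOdd Π₀ i × ¬ InOdd Π₀ j × i ≢ j ×
  ¬ Removed I Π₀ i j × ¬ Removed I Π₀ j i

-- A collection of disjoint transpositions on A' (a matching on A'),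
-- represented by the involution m (m a ≡ a means a is unmatched).
IsMatchingOn' : ∀ {n} → Permutation′ n → (Fin n → Fin n) → Set
IsMatchingOn' Π₀ m = (∀ a → m (m a) ≡ a) × (∀ a → InOdd Π₀ a → m a ≡ a)

IsMatchingT : ∀ {n} → SR n → Permutation′ n → (Fin n → Fin n) → Set
IsMatchingT I Π₀ m = ∀ a → m a ≢ a → AcceptableT I Π₀ a (m a)

IsPerfectT : ∀ {n} → Permutation′ n → (Fin n → Fin n) → Set
IsPerfectT Π₀ m = ∀ a → ¬ InOdd Π₀ a → m a ≢ a

-- stable in I_T: no acceptable blocking pair (an unmatched agent a has
-- m a ≡ a, which it ranks last, so "prefers b to m a" = "b acceptable")
IsStableT : ∀ {n} → SR n → Permutation′ n → (Fin n → Fin n) → Set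
IsStableT I Π₀ m = ¬ (Σ _ λ a → Σ _ λ b → AcceptableT I Π₀ a b ×
                      Pref I a b (m a) × Pref I b a (m b))

IsPerfectStableMatchingT : ∀ {n} → SR n → Permutation′ n → (Fin n → Fin n) → Set
IsPerfectStableMatchingT I Π₀ m =
  IsMatchingT I Π₀ m × IsPerfectT Π₀ m × IsStableT I Π₀ m

{-# OPTIONS --safe #-}
module Submission where

-- Let Π₀ be a stable partition and Π = M O the permutation that follows the
-- matching M off A(O) and the odd cycles O of Π₀ on A(O). The predecessor
-- map of Π is M off A(O) and Π₀⁻¹ on A(O), so (T1) and (T2) for Π reduce,
-- according to which agents lie in A(O), to (T1) and (T2) for Π₀, to
-- stability of M in I_T, and to the pairs deleted in I_T: these are exactly
-- the pairs that would block Π together with an agent of A(O).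
-- The one non-local point is that M must be perfect. If an agent a ∉ A(O)
-- were a fixed point of Π, then a would prefer its Π₀-predecessor to its
-- Π-predecessor; (T2) for Π and for Π₀ propagates this property along the
-- injective map b ↦ Π⁻¹(Π₀⁻¹ b), whose orbit through a returns to a, and
-- on the way back it forces a to prefer its Π-predecessor to its
-- Π₀-successor, contradicting (T1) for Π₀.

open import Defs
open import Data.Nat using (ℕ; zero; suc; _%_; _<_; _≤_; z≤n; s≤s)
open import Data.Nat.Properties using (≮⇒≥; ≤∧≢⇒<; <-irrefl; <-cmp; <-≤-trans; <-trans; ≤-refl; n<1+n)
open import Data.Fin using (Fin; toℕ; _≟_)
open import Data.Fin.Properties using (pigeonhole)
open import Data.Fin.Permutation using (Permutation′; _⟨$⟩ʳ_; _⟨$⟩ˡ_; inverseˡ; inverseʳ; permutation; flip; _∘ₚ_)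
open import Data.Product using (Σ; ∃; _×_; _,_; proj₁; proj₂)
open import Data.Sum using (_⊎_; inj₁; inj₂)
open import Data.Empty using (⊥; ⊥-elim)
open import Function.Bundles using (_⇔_; mk⇔; Injection)
open import Function.Definitions using (Injective)
open import Function.Properties.Inverse using (↔⇒↣)
open import Relation.Nullary using (¬_; yes; no)
open import Relation.Binary.PropositionalEquality using (_≡_; _≢_; refl; sym; trans; cong; subst; subst₂)
open import Relation.Binary.Definitions using (tri<; tri≈; tri>)

private
  variable
    n k k′ : ℕ

module _ (f : Fin n → Fin n) where

  iter-comm : ∀ k a → iter f k (f a) ≡ f (iter f k a)
  iter-comm zero    a = refl
  iter-comm (suc k) a = cong f (iter-comm k a)

  iter-preserves : {P : Fin n → Set} → (∀ {x} → P x → P (f x)) →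
                   ∀ a → P a → ∀ k → P (iter f k a)
  iter-preserves         step a pa zero    = pa
  iter-preserves {P = P} step a pa (suc k) = step (iter-preserves {P = P} step a pa k)

  iter-cancel : Injective _≡_ _≡_ f → ∀ {a} i j → i < j →
                iter f i a ≡ iter f j a → ∃ λ k → iter f (suc k) a ≡ a
  iter-cancel inj zero    (suc k) _         eq = k , sym eq
  iter-cancel inj (suc i) (suc j) (s≤s i<j) eq = iter-cancel inj i j i<j (inj eq)

  injective⇒periodic : Injective _≡_ _≡_ f → ∀ a → ∃ λ k → iter f (suc k) a ≡ a
  injective⇒periodic inj a
    with i , j , i<j , eq ← pigeonhole (n<1+n n) (λ i → iter f (toℕ i) a)
    = iter-cancel inj (toℕ i) (toℕ j) i<j eq

iter-agree : {S : Fin n → Set} (f g : Fin n → Fin n) →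
             (∀ {x} → S x → S (g x)) → (∀ {x} → S x → f x ≡ g x) →
             ∀ a → S a → ∀ k → iter f k a ≡ iter g k a
iter-agree         f g closed agree a sa zero    = refl
iter-agree {S = S} f g closed agree a sa (suc k) =
  trans (cong f (iter-agree {S = S} f g closed agree a sa k))
        (agree (iter-preserves g {P = S} closed a sa k))

module _ (Π : Permutation′ n) where

  ⟨$⟩ʳ-injective : Injective _≡_ _≡_ (Π ⟨$⟩ʳ_)
  ⟨$⟩ʳ-injective = Injection.injective (↔⇒↣ Π)

  ⟨$⟩ˡ-injective : Injective _≡_ _≡_ (Π ⟨$⟩ˡ_)
  ⟨$⟩ˡ-injective = Injection.injective (↔⇒↣ (flip Π))

  CycleLength-unique : ∀ {a} → CycleLength Π a k → CycleLength Π a k′ → k ≡ k′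
  CycleLength-unique {k} {k′} (1≤k , back , first) (1≤k′ , back′ , first′)
    with <-cmp k k′
  ... | tri< k<k′ _ _ = ⊥-elim (first′ k 1≤k k<k′ back)
  ... | tri≈ _ k≡k′ _ = k≡k′
  ... | tri> _ _ k′<k = ⊥-elim (first k′ 1≤k′ k′<k back′)

  CycleLength-step : ∀ {a} → CycleLength Π a k → CycleLength Π (Π ⟨$⟩ʳ a) k
  CycleLength-step {k} {a} (1≤k , back , first) =
    1≤k ,
    trans (iter-comm (Π ⟨$⟩ʳ_) k a) (cong (Π ⟨$⟩ʳ_) back) ,
    λ j 1≤j j<k eq → first j 1≤j j<k
      (⟨$⟩ʳ-injective (trans (sym (iter-comm (Π ⟨$⟩ʳ_) j a)) eq))

  CycleLength-unstep : ∀ {a} → CycleLength Π (Π ⟨$⟩ʳ a) k → CycleLength Π a k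
  CycleLength-unstep {k} {a} (1≤k , back , first) =
    1≤k ,
    ⟨$⟩ʳ-injective (trans (sym (iter-comm (Π ⟨$⟩ʳ_) k a)) back) ,
    λ j 1≤j j<k eq → first j 1≤j j<k
      (trans (iter-comm (Π ⟨$⟩ʳ_) j a) (cong (Π ⟨$⟩ʳ_) eq))

  InOdd-⟨$⟩ʳ : ∀ {a} → InOdd Π a → InOdd Π (Π ⟨$⟩ʳ a)
  InOdd-⟨$⟩ʳ (k , cyc , odd) = k , CycleLength-step cyc , odd

  InOdd-⟨$⟩ˡ : ∀ {a} → InOdd Π a → InOdd Π (Π ⟨$⟩ˡ a)
  InOdd-⟨$⟩ˡ {a} odd with k , cyc , k-odd ← subst (InOdd Π) (sym (inverseʳ Π)) odd
    = k , CycleLength-unstep cyc , k-odd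

  fixed⇒InOdd : ∀ {a} → Π ⟨$⟩ʳ a ≡ a → InOdd Π a
  fixed⇒InOdd fixed = 1 , (s≤s z≤n , fixed , λ { (suc j) (s≤s _) (s≤s ()) _ }) , refl

  involutive⇒CycleLength≡2 : ∀ {a} → Π ⟨$⟩ʳ (Π ⟨$⟩ʳ a) ≡ a → Π ⟨$⟩ʳ a ≢ a →
                             CycleLength Π a k → k ≡ 2
  involutive⇒CycleLength≡2 {k = 1}                 _     moved (_ , back , _) = ⊥-elim (moved back)
  involutive⇒CycleLength≡2 {k = 2}                 _     _     _              = refl
  involutive⇒CycleLength≡2 {k = suc (suc (suc k))} twice _     (_ , _ , first) =
    ⊥-elim (first 2 (s≤s z≤n) (s≤s (s≤s (s≤s z≤n))) twice)

CycleLength-cong : ∀ (Π Π′ : Permutation′ n) {a} →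
                   (∀ j → iter (Π ⟨$⟩ʳ_) j a ≡ iter (Π′ ⟨$⟩ʳ_) j a) →
                   CycleLength Π a k → CycleLength Π′ a k
CycleLength-cong {k = k} _ _ same (1≤k , back , first) =
  1≤k , trans (sym (same k)) back , λ j 1≤j j<k eq → first j 1≤j j<k (trans (same j) eq)

module _ (I : SR n) where

  self-not-preferred : ∀ a x → ¬ Pref I a a x
  self-not-preferred a x a≻x with x ≟ a
  ... | yes refl = <-irrefl refl a≻x
  ... | no  x≢a  = <-irrefl refl (<-trans a≻x (self-last I a x x≢a))

  Pref-complete : ∀ {a x y} → x ≢ y → ¬ Pref I a y x → Pref I a x y
  Pref-complete {a} x≢y y⊁x = ≤∧≢⇒< (≮⇒≥ y⊁x) (λ eq → x≢y (rank-inj I a eq))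

module Decomposition (Π₀ : Permutation′ n)
                     (dec : ∀ a → InOdd Π₀ a ⊎ ¬ InOdd Π₀ a)
                     (m : Fin n → Fin n) (isMatching′ : IsMatchingOn' Π₀ m) where

  private
    Odd : Fin n → Set
    Odd = InOdd Π₀

    succ₀ pred₀ : Fin n → Fin n
    succ₀ = Π₀ ⟨$⟩ʳ_
    pred₀ = Π₀ ⟨$⟩ˡ_

    m-involutive : ∀ a → m (m a) ≡ a
    m-involutive = proj₁ isMatching′

    m-fixes-odd : ∀ {a} → Odd a → m a ≡ a
    m-fixes-odd = proj₂ isMatching′ _

  m-preserves-¬odd : ∀ {a} → ¬ Odd a → ¬ Odd (m a)
  m-preserves-¬odd {a} ¬odd odd = ¬odd (subst Odd (trans (sym (m-fixes-odd odd)) (m-involutive a)) odd)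

  oddPart-odd : ∀ {a} → Odd a → oddPart Π₀ dec a ≡ succ₀ a
  oddPart-odd {a} odd with dec a
  ... | inj₁ _    = refl
  ... | inj₂ ¬odd = ⊥-elim (¬odd odd)

  oddPart-¬odd : ∀ {a} → ¬ Odd a → oddPart Π₀ dec a ≡ a
  oddPart-¬odd {a} ¬odd with dec a
  ... | inj₁ odd = ⊥-elim (¬odd odd)
  ... | inj₂ _   = refl

  oddPart⁻¹ : Fin n → Fin n
  oddPart⁻¹ b with dec b
  ... | inj₁ _ = pred₀ b
  ... | inj₂ _ = b

  oddPart⁻¹-odd : ∀ {b} → Odd b → oddPart⁻¹ b ≡ pred₀ b
  oddPart⁻¹-odd {b} odd with dec b
  ... | inj₁ _    = refl
  ... | inj₂ ¬odd = ⊥-elim (¬odd odd)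

  oddPart⁻¹-¬odd : ∀ {b} → ¬ Odd b → oddPart⁻¹ b ≡ b
  oddPart⁻¹-¬odd {b} ¬odd with dec b
  ... | inj₁ odd = ⊥-elim (¬odd odd)
  ... | inj₂ _   = refl

  oddPart-inverseˡ : ∀ b → oddPart Π₀ dec (oddPart⁻¹ b) ≡ b
  oddPart-inverseˡ b with dec b
  ... | inj₁ odd  = trans (oddPart-odd (InOdd-⟨$⟩ˡ Π₀ odd)) (inverseʳ Π₀)
  ... | inj₂ ¬odd = oddPart-¬odd ¬odd

  oddPart-inverseʳ : ∀ a → oddPart⁻¹ (oddPart Π₀ dec a) ≡ a
  oddPart-inverseʳ a with dec a
  ... | inj₁ odd  = trans (oddPart⁻¹-odd (InOdd-⟨$⟩ʳ Π₀ odd)) (inverseˡ Π₀)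
  ... | inj₂ ¬odd = oddPart⁻¹-¬odd ¬odd

  matching∘oddPart : Permutation′ n
  matching∘oddPart =
    permutation (oddPart Π₀ dec) oddPart⁻¹ oddPart-inverseˡ oddPart-inverseʳ
    ∘ₚ permutation m m m-involutive m-involutive

  module Agreeing (Π : Permutation′ n)
                  (Π≗m∘oddPart : ∀ a → Π ⟨$⟩ʳ a ≡ m (oddPart Π₀ dec a)) where

    private
      succ pred : Fin n → Fin n
      succ = Π ⟨$⟩ʳ_
      pred = Π ⟨$⟩ˡ_

    succ-odd : ∀ {a} → Odd a → succ a ≡ succ₀ a
    succ-odd odd = trans (Π≗m∘oddPart _)
      (trans (cong m (oddPart-odd odd)) (m-fixes-odd (InOdd-⟨$⟩ʳ Π₀ odd)))

    succ-¬odd : ∀ {a} → ¬ Odd a → succ a ≡ m a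
    succ-¬odd ¬odd = trans (Π≗m∘oddPart _) (cong m (oddPart-¬odd ¬odd))

    pred-odd : ∀ {a} → Odd a → pred a ≡ pred₀ a
    pred-odd odd = ⟨$⟩ʳ-injective Π
      (trans (inverseʳ Π) (sym (trans (succ-odd (InOdd-⟨$⟩ˡ Π₀ odd)) (inverseʳ Π₀))))

    pred-¬odd : ∀ {a} → ¬ Odd a → pred a ≡ m a
    pred-¬odd {a} ¬odd = ⟨$⟩ʳ-injective Π
      (trans (inverseʳ Π) (sym (trans (succ-¬odd (m-preserves-¬odd ¬odd)) (m-involutive a))))

    IsPerfectT⇒IsReduced : IsPerfectT Π₀ m → IsReduced Π
    IsPerfectT⇒IsReduced isPerfect a k cyc with dec a
    ... | inj₁ odd@(k₀ , cyc₀ , k₀-odd) =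
      inj₂ (subst OddNat (CycleLength-unique Π₀ cyc₀ (CycleLength-cong Π Π₀ same-orbit cyc))
                  k₀-odd)
      where
      same-orbit : ∀ j → iter succ j a ≡ iter succ₀ j a
      same-orbit = iter-agree succ succ₀ (InOdd-⟨$⟩ʳ Π₀) succ-odd a odd
    ... | inj₂ ¬odd = inj₁ (involutive⇒CycleLength≡2 Π twice moved cyc)
      where
      twice : succ (succ a) ≡ a
      twice = trans (cong succ (succ-¬odd ¬odd))
                    (trans (succ-¬odd (m-preserves-¬odd ¬odd)) (m-involutive a))
      moved : succ a ≢ a
      moved succ-a≡a = isPerfect a ¬odd (trans (sym (succ-¬odd ¬odd)) succ-a≡a)

    module _ (I : SR n) where

      T1₀⇒T1 : T1 I Π₀ → T1 I Π
      T1₀⇒T1 T1₀ a with dec a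
      ... | inj₁ odd  = subst₂ (λ x y → rank I a x ≤ rank I a y)
                          (sym (succ-odd odd)) (sym (pred-odd odd)) (T1₀ a)
      ... | inj₂ ¬odd = subst₂ (λ x y → rank I a x ≤ rank I a y)
                          (sym (succ-¬odd ¬odd)) (sym (pred-¬odd ¬odd)) ≤-refl

      T2₀⇒T2 : T2 I Π₀ → IsPerfectStableMatchingT I Π₀ m → T2 I Π
      T2₀⇒T2 T2₀ (isMatchingT , isPerfect , isStableT) (i , j , i≢j , i≻j , j≻i) =
        blocks (dec i) (dec j)
        where
        ¬Removed-m : ∀ {a} → ¬ Odd a → ¬ Removed I Π₀ a (m a)
        ¬Removed-m ¬odd = let (_ , _ , _ , ¬removed , _) = isMatchingT _ (isPerfect _ ¬odd) in ¬removed

        blocks : Odd i ⊎ ¬ Odd i → Odd j ⊎ ¬ Odd j → ⊥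
        blocks (inj₁ odd-i) (inj₁ odd-j) =
          T2₀ (i , j , i≢j , subst (Pref I i j) (pred-odd odd-i) i≻j ,
                             subst (Pref I j i) (pred-odd odd-j) j≻i)
        blocks (inj₁ odd-i) (inj₂ ¬odd-j) =
          ¬Removed-m ¬odd-j (i , odd-i , subst (Pref I i j) (pred-odd odd-i) i≻j ,
                                         subst (Pref I j i) (pred-¬odd ¬odd-j) j≻i)
        blocks (inj₂ ¬odd-i) (inj₁ odd-j) =
          ¬Removed-m ¬odd-i (j , odd-j , subst (Pref I j i) (pred-odd odd-j) j≻i ,
                                         subst (Pref I i j) (pred-¬odd ¬odd-i) i≻j)
        blocks (inj₂ ¬odd-i) (inj₂ ¬odd-j) = isStableT (i , j , acceptable , i≻ₘj , j≻ₘi)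
          where
          i≻ₘj = subst (Pref I i j) (pred-¬odd ¬odd-i) i≻j
          j≻ₘi = subst (Pref I j i) (pred-¬odd ¬odd-j) j≻i
          acceptable : AcceptableT I Π₀ i j
          acceptable =
            ¬odd-i , ¬odd-j , i≢j ,
            (λ (r , odd , r≻i , i≻r) → ¬Removed-m ¬odd-i (r , odd , r≻i , <-trans i≻r i≻ₘj)) ,
            (λ (r , odd , r≻j , j≻r) → ¬Removed-m ¬odd-j (r , odd , r≻j , <-trans j≻r j≻ₘi))

      T2⇒¬Removed-pred : T2 I Π → ∀ {a} → ¬ Odd a → ¬ Removed I Π₀ a (pred a)
      T2⇒¬Removed-pred T2Π ¬odd (r , odd , r≻a , a≻r) =
        T2Π (r , _ , (λ { refl → ¬odd odd }) , subst (Pref I r _) (sym (pred-odd odd)) r≻a , a≻r)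

      T2⇒IsMatchingT : T2 I Π → IsMatchingT I Π₀ m
      T2⇒IsMatchingT T2Π a ma≢a =
        ¬odd , ¬odd-m , (λ a≡ma → ma≢a (sym a≡ma)) ,
        subst (λ x → ¬ Removed I Π₀ a x) (pred-¬odd ¬odd) (T2⇒¬Removed-pred T2Π ¬odd) ,
        subst (λ x → ¬ Removed I Π₀ (m a) x) (trans (pred-¬odd ¬odd-m) (m-involutive a))
          (T2⇒¬Removed-pred T2Π ¬odd-m)
        where
        ¬odd : ¬ Odd a
        ¬odd odd = ma≢a (m-fixes-odd odd)
        ¬odd-m : ¬ Odd (m a)
        ¬odd-m = m-preserves-¬odd ¬odd

      T2⇒IsStableT : T2 I Π → IsStableT I Π₀ m
      T2⇒IsStableT T2Π (a , b , (¬odd-a , ¬odd-b , a≢b , _) , a≻b , b≻a) =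
        T2Π (a , b , a≢b , subst (Pref I a b) (sym (pred-¬odd ¬odd-a)) a≻b ,
                           subst (Pref I b a) (sym (pred-¬odd ¬odd-b)) b≻a)

      module _ (T1₀ : T1 I Π₀) (T2₀ : T2 I Π₀) (T2Π : T2 I Π) where

        Deprived Favoured : Fin n → Set
        Deprived b = Pref I b (pred₀ b) (pred b)
        Favoured c = Pref I c (pred c) (succ₀ c)

        Deprived⇒¬odd : ∀ {b} → Deprived b → ¬ Odd b
        Deprived⇒¬odd {b} deprived odd =
          <-irrefl refl (subst (Pref I b (pred₀ b)) (pred-odd odd) deprived)

        Favoured⇒¬odd : ∀ {c} → Favoured c → ¬ Odd c
        Favoured⇒¬odd {c} favoured odd =
          <-irrefl refl (<-≤-trans (subst (λ x → Pref I c x (succ₀ c)) (pred-odd odd) favoured)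
                                   (T1₀ c))

        ¬Deprived∧Favoured : ∀ {b} → Deprived b → Favoured b → ⊥
        ¬Deprived∧Favoured {b} deprived favoured =
          <-irrefl refl (<-≤-trans (<-trans deprived favoured) (T1₀ b))

        Deprived⇒Favoured-pred₀ : ∀ {b} → Deprived b → Favoured (pred₀ b)
        Deprived⇒Favoured-pred₀ {b} deprived =
          subst (Pref I e (pred e)) (sym (inverseʳ Π₀)) (Pref-complete I pred-e≢b e⊁b)
          where
          e = pred₀ b
          b≢e : b ≢ e
          b≢e b≡e = self-not-preferred I b (pred b)
                      (subst (λ x → Pref I b x (pred b)) (sym b≡e) deprived)
          e⊁b : ¬ Pref I e b (pred e)
          e⊁b e≻b = T2Π (b , e , b≢e , deprived , e≻b)
          pred-e≢b : pred e ≢ b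
          pred-e≢b pred-e≡b = <-irrefl refl (subst (Pref I b e) pred-b≡e deprived)
            where
            ¬odd = Deprived⇒¬odd deprived
            pred-b≡e : pred b ≡ e
            pred-b≡e = trans (pred-¬odd ¬odd) (trans (sym (succ-¬odd ¬odd))
                         (trans (cong succ (sym pred-e≡b)) (inverseʳ Π)))

        Favoured⇒Deprived-pred : ∀ {c} → Favoured c → Deprived (pred c)
        Favoured⇒Deprived-pred {c} favoured =
          subst (Pref I g (pred₀ g)) (sym pred-g≡c) (Pref-complete I pred₀-g≢c g⊁c)
          where
          g = pred c
          ¬odd-c = Favoured⇒¬odd favoured
          ¬odd-g : ¬ Odd g
          ¬odd-g odd = ¬odd-c (subst Odd (trans (sym (succ-odd odd)) (inverseʳ Π))
                                         (InOdd-⟨$⟩ʳ Π₀ odd))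
          pred-g≡c : pred g ≡ c
          pred-g≡c = trans (pred-¬odd ¬odd-g) (trans (cong m (pred-¬odd ¬odd-c)) (m-involutive c))
          c≢g : c ≢ g
          c≢g c≡g = self-not-preferred I c (succ₀ c)
                      (subst (λ x → Pref I c x (succ₀ c)) (sym c≡g) favoured)
          g⊁c : ¬ Pref I g c (pred₀ g)
          g⊁c g≻c = T2₀ (c , g , c≢g , <-≤-trans favoured (T1₀ c) , g≻c)
          pred₀-g≢c : pred₀ g ≢ c
          pred₀-g≢c pred₀-g≡c = <-irrefl refl (subst (Pref I c g) succ₀-c≡g favoured)
            where
            succ₀-c≡g : succ₀ c ≡ g
            succ₀-c≡g = trans (cong succ₀ (sym pred₀-g≡c)) (inverseʳ Π₀)

        T2⇒IsPerfectT : IsPerfectT Π₀ m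
        T2⇒IsPerfectT a ¬odd ma≡a = ¬Deprived∧Favoured deprived-a favoured-a
          where
          pred-a≡a : pred a ≡ a
          pred-a≡a = trans (pred-¬odd ¬odd) ma≡a
          pred₀-a≢a : pred₀ a ≢ a
          pred₀-a≢a eq = ¬odd (fixed⇒InOdd Π₀ (trans (cong succ₀ (sym eq)) (inverseʳ Π₀)))
          deprived-a : Deprived a
          deprived-a = subst (Pref I a (pred₀ a)) (sym pred-a≡a) (self-last I a (pred₀ a) pred₀-a≢a)
          φ : Fin n → Fin n
          φ b = pred (pred₀ b)
          φ-injective : Injective _≡_ _≡_ φ
          φ-injective eq = ⟨$⟩ˡ-injective Π₀ (⟨$⟩ˡ-injective Π eq)
          favoured-a : Favoured a
          favoured-a with k , φx≡a ← injective⇒periodic φ φ-injective a =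
            subst Favoured (⟨$⟩ˡ-injective Π (trans φx≡a (sym pred-a≡a)))
              (Deprived⇒Favoured-pred₀ (iter-preserves φ {P = Deprived} φ-preserves a deprived-a k))
            where
            φ-preserves : ∀ {b} → Deprived b → Deprived (φ b)
            φ-preserves d = Favoured⇒Deprived-pred (Deprived⇒Favoured-pred₀ d)

  matching∘oddPart-reducedStable : (I : SR n) → IsStablePartition I Π₀ →
                                   IsPerfectStableMatchingT I Π₀ m →
                                   IsStablePartition I matching∘oddPart × IsReduced matching∘oddPart
  matching∘oddPart-reducedStable I (T1₀ , T2₀) perfectStable@(_ , isPerfect , _) =
    (T1₀⇒T1 I T1₀ , T2₀⇒T2 I T2₀ perfectStable) , IsPerfectT⇒IsReduced isPerfect
    where open Agreeing matching∘oddPart (λ _ → refl)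

  T2⇒IsPerfectStableMatchingT : (I : SR n) → IsStablePartition I Π₀ →
                                (Π : Permutation′ n) →
                                (∀ a → Π ⟨$⟩ʳ a ≡ m (oddPart Π₀ dec a)) →
                                T2 I Π → IsPerfectStableMatchingT I Π₀ m
  T2⇒IsPerfectStableMatchingT I (T1₀ , T2₀) Π Π≗m∘oddPart T2Π =
    T2⇒IsMatchingT I T2Π , T2⇒IsPerfectT I T1₀ T2₀ T2Π , T2⇒IsStableT I T2Π
    where open Agreeing Π Π≗m∘oddPart

theorem19 : (n : ℕ) → n % 2 ≡ 0 → (I : SR n) →
    (Π₀ : Permutation′ n) → IsStablePartition I Π₀ →
    (dec : ∀ a → InOdd Π₀ a ⊎ ¬ InOdd Π₀ a) →
    (m : Fin n → Fin n) → IsMatchingOn' Π₀ m →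
    IsPerfectStableMatchingT I Π₀ m ⇔
      Σ (Permutation′ n) (λ Π →
        (∀ a → Π ⟨$⟩ʳ a ≡ m (oddPart Π₀ dec a)) ×
        IsStablePartition I Π × IsReduced Π)
theorem19 _ _ I Π₀ stable₀ dec m isMatching′ = mk⇔
  (λ perfectStable → matching∘oddPart , (λ _ → refl) ,
                     matching∘oddPart-reducedStable I stable₀ perfectStable)
  (λ (Π , Π≗m∘oddPart , (_ , T2Π) , _) →
     T2⇒IsPerfectStableMatchingT I stable₀ Π Π≗m∘oddPart T2Π)
  where open Decomposition Π₀ dec m isMatching′
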